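{- Let $G$ be a graph of order $n\ge 2$ and let $H$ be a graph with at least two vertices and root vertex $v$. Then $$n(\gamma_R(H)-1)+\gamma(G)\le \gamma_R(G\circ H)\le n\gamma_R(H).$$
   Context: All graphs are finite, simple and undirected. $\gamma(G)$ is the domination number (minimum size of a set $D$ such that every vertex outside $D$ has a neighbor in $D$). A Roman dominating function on a graph $G=(V,E)$ is a map $f:V\to\{0,1,2\}$ such that every vertex $u$ with $f(u)=0$ has a neighbor $w$ with $f(w)=2$; its weight is $\sum_{u\in V}f(u)$, and $\gamma_R(G)$ is the minimum weight of a Roman dominating function. For a graph $G$ with vertex set $\{v_1,\dots,v_n\}$ and a graph $H$ with root $v$, the rooted product $G\circ H$ is obtained from one copy of $G$ and $n$ copies $H_1,\dots,H_n$ of $H$ by identifying, for each $i$, $v_i$ with the copy of $v$ in $H_i$. -}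

module Defs where

open import Data.Nat using (ℕ; zero; suc; _+_; _*_; _≤_)
open import Data.Fin using (Fin; remQuot)
open import Data.Fin.Subset using (Subset; _∈_; _∉_; ∣_∣)
open import Data.List using (List; map; allFin)
open import Data.Nat.ListAction using (sum)
open import Data.Product using (Σ; ∃; _×_; _,_; proj₁; proj₂)
open import Data.Sum using (_⊎_)
open import Relation.Binary.PropositionalEquality using (_≡_)
open import Relation.Nullary using (¬_)

record Graph (n : ℕ) : Set₁ where
  field
    Adj   : Fin n → Fin n → Set
    sym   : ∀ {x y} → Adj x y → Adj y x
    irrefl : ∀ {x} → ¬ Adj x x
open Graph public

IsDominating : ∀ {n} → Graph n → Subset n → Set
IsDominating {n} G D = ∀ (u : Fin n) → u ∉ D → ∃ λ w → w ∈ D × Adj G u w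

IsDominationNumber : ∀ {n} → Graph n → ℕ → Set
IsDominationNumber {n} G k =
  (∃ λ D → IsDominating G D × ∣ D ∣ ≡ k) ×
  (∀ D → IsDominating G D → k ≤ ∣ D ∣)

-- Roman dominating functions f : V → {0,1,2}, values encoded as Fin 3.
val : Fin 3 → ℕ
val Fin.zero = 0
val (Fin.suc Fin.zero) = 1
val (Fin.suc (Fin.suc Fin.zero)) = 2

IsRomanDominating : ∀ {n} → Graph n → (Fin n → Fin 3) → Set
IsRomanDominating {n} G f =
  ∀ (u : Fin n) → val (f u) ≡ 0 → ∃ λ w → Adj G u w × val (f w) ≡ 2

weight : ∀ {n} → (Fin n → Fin 3) → ℕ
weight {n} f = sum (map (λ u → val (f u)) (allFin n))

IsRomanDominationNumber : ∀ {n} → Graph n → ℕ → Set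
IsRomanDominationNumber {n} G k =
  (∃ λ f → IsRomanDominating G f × weight f ≡ k) ×
  (∀ f → IsRomanDominating G f → k ≤ weight f)

-- Rooted product G ∘ H, vertex set Fin (n * m), where the vertex
-- with remQuot = (i , a) is vertex a of the copy H_i; the root v of
-- H_i is identified with v_i of G.
RPAdj : ∀ {n m} → Graph n → Graph m → Fin m → (Fin n × Fin m) → (Fin n × Fin m) → Set
RPAdj G H v (i , a) (j , b) = (i ≡ j × Adj H a b) ⊎ (a ≡ v × b ≡ v × Adj G i j)

rootedProduct : ∀ {n m} → Graph n → Graph m → Fin m → Graph (n * m)
rootedProduct {n} {m} G H v = record
  { Adj = λ x y → RPAdj G H v (remQuot m x) (remQuot m y)
  ; sym = λ {x} {y} → symP {x} {y}
  ; irrefl = λ {x} → irr {x}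
  }
  where
  open import Relation.Binary.PropositionalEquality renaming (sym to ≡-sym)
  open import Data.Sum using (inj₁; inj₂)
  symP : ∀ {x y} → RPAdj G H v (remQuot m x) (remQuot m y) → RPAdj G H v (remQuot m y) (remQuot m x)
  symP (inj₁ (e , a)) = inj₁ (≡-sym e , Graph.sym H a)
  symP (inj₂ (e₁ , e₂ , a)) = inj₂ (e₂ , e₁ , Graph.sym G a)
  irr : ∀ {x} → ¬ RPAdj G H v (remQuot m x) (remQuot m x)
  irr (inj₁ (_ , a)) = Graph.irrefl H a
  irr (inj₂ (_ , _ , a)) = Graph.irrefl G a

module Submission where

-- Upper bound: labelling every copy H_i by one optimal Roman dominating
-- function of H gives a Roman dominating function of G ∘ H of weight n γR(H).
--
-- Lower bound: let f be a Roman dominating function of G ∘ H and f_i its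
-- restriction to the copy H_i.  Vertices of H_i other than the root have
-- all their G ∘ H-neighbours inside H_i, so they are Roman dominated by f_i.
-- Hence raising a root label 0 to 1 turns f_i into a Roman dominating
-- function of H, and every copy weighs at least γR(H) − 1.  Call i good
-- when f_i itself is Roman dominating on H; good copies weigh at least
-- γR(H) ≥ 1.  A bad copy has root label 0 and its root is dominated by
-- the root of an adjacent copy with label 2, which is good; so the good
-- indices dominate G and there are at least γ(G) of them.  Summing over
-- the copies gives the bound.  Goodness of a copy need not be decidable
-- (adjacency is an arbitrary relation), so the split into good and bad
-- copies is made under a double negation, which is harmless because the
-- conclusion is a decidable inequality.

open import Defs hiding (sym)
open import Data.Nat using (ℕ; zero; suc; _+_; _*_; _∸_; _≤_; z≤n; s≤s; _≤?_)
open import Data.Nat.Properties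
  using (≤-trans; ≤-reflexive; +-mono-≤; +-monoˡ-≤; +-monoʳ-≤; m≤m+n; +-comm; +-assoc;
         m+n∸n≡m; ∸-monoˡ-≤; m+[n∸m]≡n; +-0-commutativeMonoid; +-commutativeSemigroup;
         module ≤-Reasoning)
  renaming (_≟_ to _≟ℕ_)
open import Data.Fin using (Fin; zero; suc; combine; remQuot; _↑ˡ_; _↑ʳ_; _≟_)
open import Data.Fin.Properties using (punchInᵢ≢i; remQuot-combine; combine-remQuot; sequence)
open import Data.Fin.Subset using (Subset; _∈_; ∣_∣)
open import Data.List using (map; allFin) renaming (tabulate to listTabulate)
open import Data.List.Properties using (map-tabulate)
open import Data.Nat.ListAction using () renaming (sum to listSum)
open import Data.Product using (∃; _×_; _,_; proj₂; uncurry)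
open import Data.Sum using (_⊎_; inj₁; inj₂)
open import Data.Vec using ([]; _∷_; here; there)
open import Data.Vec.Functional using (Vector; removeAt; updateAt)
open import Data.Vec.Functional.Properties using (updateAt-updates; updateAt-minimal)
open import Effect.Monad using (RawMonad)
open import Function using (_∘_; id)
open import Relation.Binary.PropositionalEquality
  using (_≡_; _≢_; refl; sym; trans; cong; subst; subst₂; module ≡-Reasoning)
open import Relation.Nullary using (yes; no; does)
open import Relation.Nullary.Decidable using (dec-true; decidable-stable)
open import Relation.Nullary.Negation using (DoubleNegation; ¬¬-Monad; ¬¬-map; contradiction)
open import Relation.Nullary.Decidable.Core using (¬¬-excluded-middle)
open import Relation.Unary using (Pred; Decidable)
open import Level using (0ℓ)
open import Algebra.Properties.CommutativeMonoid.Sum +-0-commutativeMonoid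
  using (sum; sum-syntax; sum-remove; sum-cong-≗)
open import Algebra.Properties.CommutativeSemigroup +-commutativeSemigroup
  using (xy∙z≈xz∙y; interchange)

listSum≡sum : ∀ {n} (t : Fin n → ℕ) → listSum (map t (allFin n)) ≡ sum t
listSum≡sum {n} t = trans (cong listSum (map-tabulate id t)) (tabulated t)
  where
  tabulated : ∀ {k} (u : Fin k → ℕ) → listSum (listTabulate u) ≡ sum u
  tabulated {zero}  u = refl
  tabulated {suc k} u = cong (u zero +_) (tabulated (u ∘ suc))

∑-split : ∀ m k (t : Fin (m + k) → ℕ) →
  sum t ≡ sum (t ∘ (_↑ˡ k)) + sum (t ∘ (m ↑ʳ_))
∑-split zero    k t = refl
∑-split (suc m) k t =
  trans (cong (t zero +_) (∑-split m k (t ∘ suc))) (sym (+-assoc (t zero) _ _))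

∑-combine : ∀ n m (t : Fin (n * m) → ℕ) → sum t ≡ ∑[ i < n ] ∑[ a < m ] t (combine i a)
∑-combine zero    m t = refl
∑-combine (suc n) m t =
  trans (∑-split m (n * m) t)
        (cong (sum (t ∘ (_↑ˡ (n * m))) +_) (∑-combine n m (t ∘ (m ↑ʳ_))))

∑-const : ∀ n c → ∑[ i < n ] c ≡ n * c
∑-const zero    c = refl
∑-const (suc n) c = cong (c +_) (∑-const n c)

term≤sum : ∀ {n} (t : Vector ℕ n) i → t i ≤ sum t
term≤sum {suc n} t i = ≤-trans (m≤m+n (t i) _) (≤-reflexive (sym (sum-remove {i = i} t)))

sum-change-one : ∀ {n} (t u : Vector ℕ n) i k →
  (∀ j → j ≢ i → u j ≡ t j) → u i ≤ t i + k → sum u ≤ sum t + k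
sum-change-one {suc n} t u i k others ui≤ = begin
  sum u                         ≡⟨ sum-remove {i = i} u ⟩
  u i + sum (removeAt u i)      ≡⟨ cong (u i +_) (sum-cong-≗ (λ j → others _ (punchInᵢ≢i i j))) ⟩
  u i + sum (removeAt t i)      ≤⟨ +-monoˡ-≤ _ ui≤ ⟩
  t i + k + sum (removeAt t i)  ≡⟨ xy∙z≈xz∙y (t i) k _ ⟩
  t i + sum (removeAt t i) + k  ≡⟨ cong (_+ k) (sum-remove {i = i} t) ⟨
  sum t + k                     ∎
  where open ≤-Reasoning

select : ∀ {n ℓ} {P : Pred (Fin n) ℓ} → Decidable P → Subset n
select {zero}  P? = []
select {suc n} P? = does (P? zero) ∷ select (P? ∘ suc)

∈-select : ∀ {n ℓ} {P : Pred (Fin n) ℓ} (P? : Decidable P) {i} → P i → i ∈ select P?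
∈-select {suc n} P? {zero}  p rewrite dec-true (P? zero) p = here
∈-select {suc n} P? {suc i} p = there (∈-select (P? ∘ suc) p)

sum≥select : ∀ {n ℓ} {P : Pred (Fin n) ℓ} (P? : Decidable P) (t : Fin n → ℕ) c →
  (∀ i → c ≤ t i) → (∀ i → P i → suc c ≤ t i) → n * c + ∣ select P? ∣ ≤ sum t
sum≥select {zero}  P? t c low high = z≤n
sum≥select {suc n} P? t c low high with P? zero
... | yes p = begin
  (c + n * c) + (1 + ∣ rest ∣)  ≡⟨ interchange c (n * c) 1 _ ⟩
  (c + 1) + (n * c + ∣ rest ∣)  ≤⟨ +-mono-≤ (≤-reflexive (+-comm c 1)) tail-bound ⟩
  suc c + sum (t ∘ suc)         ≤⟨ +-monoˡ-≤ _ (high zero p) ⟩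
  sum t                         ∎
  where
  open ≤-Reasoning
  rest = select (P? ∘ suc)
  tail-bound = sum≥select (P? ∘ suc) (t ∘ suc) c (low ∘ suc) (high ∘ suc)
... | no _ = begin
  (c + n * c) + ∣ rest ∣  ≡⟨ +-assoc c _ _ ⟩
  c + (n * c + ∣ rest ∣)  ≤⟨ +-mono-≤ (low zero) tail-bound ⟩
  sum t                   ∎
  where
  open ≤-Reasoning
  rest = select (P? ∘ suc)
  tail-bound = sum≥select (P? ∘ suc) (t ∘ suc) c (low ∘ suc) (high ∘ suc)

¬¬-decidable : ∀ {n} (P : Pred (Fin n) 0ℓ) → DoubleNegation (Decidable P)
¬¬-decidable P = sequence (RawMonad.rawApplicative ¬¬-Monad) (λ i → ¬¬-excluded-middle)

weight≡sum : ∀ {m} (g : Fin m → Fin 3) → weight g ≡ ∑[ a < m ] val (g a)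
weight≡sum g = listSum≡sum (val ∘ g)

weight-cong : ∀ {m} {g h : Fin m → Fin 3} → (∀ a → g a ≡ h a) → weight g ≡ weight h
weight-cong {g = g} {h} g≗h = begin
  weight g       ≡⟨ weight≡sum g ⟩
  sum (val ∘ g)  ≡⟨ sum-cong-≗ (cong val ∘ g≗h) ⟩
  sum (val ∘ h)  ≡⟨ weight≡sum h ⟨
  weight h       ∎
  where open ≡-Reasoning

label≤weight : ∀ {m} (g : Fin m → Fin 3) w → val (g w) ≤ weight g
label≤weight g w = subst (val (g w) ≤_) (sym (weight≡sum g)) (term≤sum (val ∘ g) w)

-- A Roman dominating function on a graph with a vertex has positive weight:
-- either that vertex has a positive label or it has a neighbour labelled 2.
weight-positive : ∀ {m} {H : Graph m} (g : Fin m → Fin 3) →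
  IsRomanDominating H g → Fin m → 1 ≤ weight g
weight-positive g gR u with val (g u) in eq
... | suc _ = ≤-trans (subst (1 ≤_) (sym eq) (s≤s z≤n)) (label≤weight g u)
... | zero with gR u eq
...   | w , _ , w2 = ≤-trans (subst (1 ≤_) (sym w2) (s≤s z≤n)) (label≤weight g w)

romanNumber-positive : ∀ {m} {H : Graph m} {γ} → IsRomanDominationNumber H γ → Fin m → 1 ≤ γ
romanNumber-positive {H = H} ((g , gR , weight≡γ) , _) u =
  subst (1 ≤_) weight≡γ (weight-positive {H = H} g gR u)

raise : Fin 3 → Fin 3
raise zero = suc zero
raise (suc x) = suc x

raise-nonzero : ∀ x → val (raise x) ≢ 0
raise-nonzero zero             ()
raise-nonzero (suc zero)       ()
raise-nonzero (suc (suc zero)) ()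

raise-keeps-2 : ∀ x → val x ≡ 2 → val (raise x) ≡ 2
raise-keeps-2 (suc (suc zero)) refl = refl

raise≤ : ∀ x → val (raise x) ≤ val x + 1
raise≤ zero             = s≤s z≤n
raise≤ (suc zero)       = s≤s z≤n
raise≤ (suc (suc zero)) = s≤s (s≤s z≤n)

raiseAt : ∀ {m} → (Fin m → Fin 3) → Fin m → Fin m → Fin 3
raiseAt g v = updateAt g v raise

raiseAt-keeps-2 : ∀ {m} (g : Fin m → Fin 3) v b → val (g b) ≡ 2 → val (raiseAt g v b) ≡ 2
raiseAt-keeps-2 g v b b2 with b ≟ v
... | yes refl = trans (cong val (updateAt-updates v g)) (raise-keeps-2 (g v) b2)
... | no b≢v   = trans (cong val (updateAt-minimal b v g b≢v)) b2

raiseAt-roman : ∀ {m} (H : Graph m) (g : Fin m → Fin 3) v →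
  (∀ a → a ≢ v → val (g a) ≡ 0 → ∃ λ b → Adj H a b × val (g b) ≡ 2) →
  IsRomanDominating H (raiseAt g v)
raiseAt-roman H g v off a z with a ≟ v
... | yes refl =
  contradiction (trans (cong val (sym (updateAt-updates v g))) z) (raise-nonzero (g v))
... | no a≢v with off a a≢v (trans (cong val (sym (updateAt-minimal a v g a≢v))) z)
...   | b , ab , b2 = b , ab , raiseAt-keeps-2 g v b b2

raiseAt-weight : ∀ {m} (g : Fin m → Fin 3) v → weight (raiseAt g v) ≤ weight g + 1
raiseAt-weight g v = begin
  weight (raiseAt g v)     ≡⟨ weight≡sum (raiseAt g v) ⟩
  sum (val ∘ raiseAt g v)  ≤⟨ sum-change-one (val ∘ g) (val ∘ raiseAt g v) v 1 unchanged raised ⟩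
  sum (val ∘ g) + 1        ≡⟨ cong (_+ 1) (weight≡sum g) ⟨
  weight g + 1             ∎
  where
  open ≤-Reasoning
  unchanged : ∀ a → a ≢ v → val (raiseAt g v a) ≡ val (g a)
  unchanged a a≢v = cong val (updateAt-minimal a v g a≢v)
  raised : val (raiseAt g v v) ≤ val (g v) + 1
  raised = subst (λ x → val x ≤ val (g v) + 1) (sym (updateAt-updates v g)) (raise≤ (g v))

almost-roman-weight : ∀ {m} {H : Graph m} {γ} → IsRomanDominationNumber H γ →
  ∀ (g : Fin m → Fin 3) v →
  (∀ a → a ≢ v → val (g a) ≡ 0 → ∃ λ b → Adj H a b × val (g b) ≡ 2) →
  γ ∸ 1 ≤ weight g
almost-roman-weight {H = H} {γ} (_ , minimal) g v off = begin
  γ ∸ 1               ≤⟨ ∸-monoˡ-≤ 1 raised-bound ⟩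
  (weight g + 1) ∸ 1  ≡⟨ m+n∸n≡m (weight g) 1 ⟩
  weight g            ∎
  where
  open ≤-Reasoning
  raised-bound : γ ≤ weight g + 1
  raised-bound = ≤-trans (minimal _ (raiseAt-roman H g v off)) (raiseAt-weight g v)

module RootedProduct {n m} (G : Graph n) (H : Graph m) (v : Fin m) where

  G∘H : Graph (n * m)
  G∘H = rootedProduct G H v

  by-copies : ∀ {ℓ} (P : Fin (n * m) → Set ℓ) →
    (∀ (i : Fin n) (a : Fin m) → P (combine i a)) → ∀ x → P x
  by-copies P p x = subst P (combine-remQuot {n} m x) (p _ _)

  copy-adj : ∀ i {a b} → Adj H a b → Adj G∘H (combine i a) (combine i b)
  copy-adj i ab =
    subst₂ (RPAdj G H v) (sym (remQuot-combine i _)) (sym (remQuot-combine i _)) (inj₁ (refl , ab))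

  neighbour : ∀ {i a} w → Adj G∘H (combine i a) w →
    (∃ λ b → w ≡ combine i b × Adj H a b) ⊎
    (a ≡ v × ∃ λ j → w ≡ combine j v × Adj G i j)
  neighbour {i} {a} w adj =
    classify w (remQuot m w) (combine-remQuot {n} m w)
      (subst (λ p → RPAdj G H v p (remQuot m w)) (remQuot-combine i a) adj)
    where
    classify : ∀ w p → uncurry combine p ≡ w → RPAdj G H v (i , a) p →
      (∃ λ b → w ≡ combine i b × Adj H a b) ⊎
      (a ≡ v × ∃ λ j → w ≡ combine j v × Adj G i j)
    classify _ (_ , b) refl (inj₁ (refl , ab))       = inj₁ (b , refl , ab)
    classify _ (j , _) refl (inj₂ (a≡v , refl , ij)) = inj₂ (a≡v , j , refl , ij)

  copy : (Fin (n * m) → Fin 3) → Fin n → Fin m → Fin 3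
  copy f i a = f (combine i a)

  weight-copies : (f : Fin (n * m) → Fin 3) → weight f ≡ ∑[ i < n ] weight (copy f i)
  weight-copies f = begin
    weight f                                ≡⟨ weight≡sum f ⟩
    sum (val ∘ f)                           ≡⟨ ∑-combine n m (val ∘ f) ⟩
    ∑[ i < n ] ∑[ a < m ] val (copy f i a)  ≡⟨ sum-cong-≗ (λ i → sym (weight≡sum (copy f i))) ⟩
    ∑[ i < n ] weight (copy f i)            ∎
    where open ≡-Reasoning

  copy-dominated : ∀ {f} → IsRomanDominating G∘H f → ∀ i a → val (copy f i a) ≡ 0 →
    (∃ λ b → Adj H a b × val (copy f i b) ≡ 2) ⊎
    (a ≡ v × ∃ λ j → Adj G i j × val (copy f j v) ≡ 2)
  copy-dominated fR i a z with fR (combine i a) z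
  ... | w , adj , w2 with neighbour w adj
  ...   | inj₁ (b , refl , ab)        = inj₁ (b , ab , w2)
  ...   | inj₂ (a≡v , j , refl , ij) = inj₂ (a≡v , j , ij , w2)

  spread : (Fin m → Fin 3) → Fin (n * m) → Fin 3
  spread g x = g (proj₂ (remQuot {n} m x))

  copy-spread : ∀ g i a → copy (spread g) i a ≡ g a
  copy-spread g i a = cong (g ∘ proj₂) (remQuot-combine i a)

  spread-roman : ∀ {g} → IsRomanDominating H g → IsRomanDominating G∘H (spread g)
  spread-roman {g} gR = by-copies _ dominated
    where
    dominated : ∀ i a → val (spread g (combine i a)) ≡ 0 →
      ∃ λ w → Adj G∘H (combine i a) w × val (spread g w) ≡ 2
    dominated i a z with gR a (trans (cong val (sym (copy-spread g i a))) z)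
    ... | b , ab , b2 = combine i b , copy-adj i ab , trans (cong val (copy-spread g i b)) b2

  weight-spread : ∀ g → weight (spread g) ≡ n * weight g
  weight-spread g = begin
    weight (spread g)                      ≡⟨ weight-copies (spread g) ⟩
    ∑[ i < n ] weight (copy (spread g) i)  ≡⟨ sum-cong-≗ (λ i → weight-cong (copy-spread g i)) ⟩
    ∑[ i < n ] weight g                    ≡⟨ ∑-const n (weight g) ⟩
    n * weight g                           ∎
    where open ≡-Reasoning

  upper-bound : ∀ {γRH γRGH} → IsRomanDominationNumber H γRH →
    IsRomanDominationNumber G∘H γRGH → γRGH ≤ n * γRH
  upper-bound ((g , gR , weight≡γRH) , _) (_ , minimal) =
    subst (λ x → _ ≤ n * x) weight≡γRH
      (subst (_ ≤_) (weight-spread g) (minimal (spread g) (spread-roman gR)))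

  module Copies {f} (fR : IsRomanDominating G∘H f) where

    Good : Pred (Fin n) 0ℓ
    Good i = IsRomanDominating H (copy f i)

    -- Off the root, all neighbours of a vertex of H_i lie in H_i.
    off-root-dominated : ∀ i a → a ≢ v → val (copy f i a) ≡ 0 →
      ∃ λ b → Adj H a b × val (copy f i b) ≡ 2
    off-root-dominated i a a≢v z with copy-dominated fR i a z
    ... | inj₁ inside-copy = inside-copy
    ... | inj₂ (a≡v , _)   = contradiction a≡v a≢v

    good-if-root-dominated : ∀ i →
      (val (copy f i v) ≡ 0 → ∃ λ b → Adj H v b × val (copy f i b) ≡ 2) → Good i
    good-if-root-dominated i root a z with a ≟ v
    ... | yes refl = root z
    ... | no a≢v   = off-root-dominated i a a≢v z

    good-if-root-2 : ∀ i → val (copy f i v) ≡ 2 → Good i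
    good-if-root-2 i root2 =
      good-if-root-dominated i (λ z → contradiction (trans (sym root2) z) λ ())

    -- The good indices dominate G: a bad copy has an undominated root,
    -- which therefore is dominated from the root of an adjacent copy
    -- labelled 2, and a copy with root label 2 is good.
    good-dominate : (good? : Decidable Good) → IsDominating G (select good?)
    good-dominate good? u u∉ with val (copy f u v) ≟ℕ 0
    ... | no root≢0 =
      contradiction (∈-select good? (good-if-root-dominated u (λ z → contradiction z root≢0))) u∉
    ... | yes root≡0 with copy-dominated fR u v root≡0
    ...   | inj₁ inside-copy =
      contradiction (∈-select good? (good-if-root-dominated u (λ _ → inside-copy))) u∉
    ...   | inj₂ (_ , j , uj , j2) = j , ∈-select good? (good-if-root-2 j j2) , uj

    copy-weight : ∀ {γRH} → IsRomanDominationNumber H γRH →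
      ∀ i → γRH ∸ 1 ≤ weight (copy f i)
    copy-weight optH i = almost-roman-weight {H = H} optH (copy f i) v (off-root-dominated i)

    good-copy-weight : ∀ {γRH} → IsRomanDominationNumber H γRH →
      ∀ i → Good i → suc (γRH ∸ 1) ≤ weight (copy f i)
    good-copy-weight optH i good = subst (_≤ weight (copy f i))
      (sym (m+[n∸m]≡n (romanNumber-positive {H = H} optH v))) (proj₂ optH _ good)

    lower-bound : ∀ {γG γRH} → IsDominationNumber G γG → IsRomanDominationNumber H γRH →
      n * (γRH ∸ 1) + γG ≤ weight f
    lower-bound {γG} {γRH} (_ , minimalG) optH =
      decidable-stable (_ ≤? _) (¬¬-map split-bound (¬¬-decidable Good))
      where
      split-bound : Decidable Good → n * (γRH ∸ 1) + γG ≤ weight f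
      split-bound good? = begin
        n * (γRH ∸ 1) + γG                ≤⟨ +-monoʳ-≤ _ (minimalG _ (good-dominate good?)) ⟩
        n * (γRH ∸ 1) + ∣ select good? ∣  ≤⟨ sum≥select good? _ _ (copy-weight optH)
                                                (good-copy-weight optH) ⟩
        ∑[ i < n ] weight (copy f i)      ≡⟨ weight-copies f ⟨
        weight f                          ∎
        where open ≤-Reasoning

-- The theorem.

mainTheorem2 : ∀ {n m} (G : Graph n) (H : Graph m) (v : Fin m) →
    2 ≤ n → 2 ≤ m →
    ∀ {γG γRH γRGH : ℕ} →
    IsDominationNumber G γG →
    IsRomanDominationNumber H γRH →
    IsRomanDominationNumber (rootedProduct G H v) γRGH →
    (n * (γRH ∸ 1) + γG ≤ γRGH) × (γRGH ≤ n * γRH)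
mainTheorem2 G H v _ _ optG optH optGH@((f , fR , weight≡γRGH) , _) =
  subst (_ ≤_) weight≡γRGH (Copies.lower-bound fR optG optH) ,
  upper-bound optH optGH
  where open RootedProduct G H v
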